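{- Let $(X,\mathcal{L})$ be a transitive avoidance game and suppose that its automorphism group contains a fixed-point-free involution. Then the game is not a Player I win.
   Context: An avoidance game consists of a finite set $X$ (the board) and a family $\mathcal{L}$ of subsets of $X$ (the lines). Two players, Player I and Player II, alternately claim previously unclaimed points of $X$, Player I moving first. The first player to have claimed all points of some line loses; if all points have been claimed and neither player has completed a line, the game is a draw. The automorphism group is the group of permutations of $X$ mapping $\mathcal{L}$ onto $\mathcal{L}$; the game is transitive if this group acts transitively on $X$. The game is a Player I win if Player I has a strategy guaranteeing that Player II loses. -}

module Defs where

open import Data.Nat using (ℕ)
open import Data.Fin using (Fin; _≟_)
open import Data.Fin.Subset using (Subset; _∈_)
open import Data.Fin.Permutation using (Permutation′; _⟨$⟩ʳ_; _⟨$⟩ˡ_)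
open import Data.Vec using (tabulate; lookup)
open import Data.List using (List)
import Data.List.Membership.Propositional as LM
open import Data.Product using (Σ; ∃; _×_)
open import Data.Sum using (_⊎_)
open import Relation.Binary.PropositionalEquality using (_≡_; _≢_)
open import Relation.Nullary using (¬_; yes; no)

record AvoidanceGame (n : ℕ) : Set where
  constructor mkGame
  field
    lines : List (Subset n)

open AvoidanceGame public

image : ∀ {n} → Permutation′ n → Subset n → Subset n
image σ L = tabulate (λ y → lookup L (σ ⟨$⟩ˡ y))

IsAutomorphism : ∀ {n} → AvoidanceGame n → Permutation′ n → Set
IsAutomorphism G σ =
  (∀ L → L LM.∈ lines G → image σ L LM.∈ lines G) ×
  (∀ M → M LM.∈ lines G → Σ (Subset _) λ L → (L LM.∈ lines G) × (image σ L ≡ M))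

Transitive : ∀ {n} → AvoidanceGame n → Set
Transitive {n} G = ∀ (x y : Fin n) →
  Σ (Permutation′ n) λ σ → IsAutomorphism G σ × (σ ⟨$⟩ʳ x ≡ y)

HasFPFInvolution : ∀ {n} → AvoidanceGame n → Set
HasFPFInvolution {n} G =
  Σ (Permutation′ n) λ σ → IsAutomorphism G σ ×
    (∀ x → σ ⟨$⟩ʳ (σ ⟨$⟩ʳ x) ≡ x) × (∀ x → σ ⟨$⟩ʳ x ≢ x)

data Player : Set where
  I II : Player

data Cell : Set where
  free : Cell
  owned : Player → Cell

Position : ℕ → Set
Position n = Fin n → Cell

start : ∀ {n} → Position n
start _ = free

claim : ∀ {n} → Position n → Fin n → Player → Position n
claim s x p y with y ≟ x
... | yes _ = owned p
... | no _  = s y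

CompletedLine : ∀ {n} → AvoidanceGame n → Position n → Player → Set
CompletedLine G s p =
  Σ (Subset _) λ L → (L LM.∈ lines G) × (∀ x → x ∈ L → s x ≡ owned p)

-- IWinI s  : it is Player I's turn at s (no line completed yet), and I can force
--            Player II to be the first to complete a line.
-- IWinII s : likewise, Player II's turn at s.
mutual
  data IWinI {n} (G : AvoidanceGame n) (s : Position n) : Set where
    move : (x : Fin n) → s x ≡ free →
           ¬ CompletedLine G (claim s x I) I →
           IWinII G (claim s x I) → IWinI G s

  data IWinII {n} (G : AvoidanceGame n) (s : Position n) : Set where
    -- the board is not full (otherwise the game is a draw), and whatever
    -- unclaimed point Player II claims, either II completes a line (and loses),
    -- or Player I still wins from the resulting position.
    respond : (∃ λ x → s x ≡ free) →
              (∀ x → s x ≡ free →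
                 CompletedLine G (claim s x II) II ⊎ IWinI G (claim s x II)) →
              IWinII G s

PlayerIWin : ∀ {n} → AvoidanceGame n → Set
PlayerIWin G = IWinI G start

-- Player II answers each move x of Player I with σ x, where σ is the
-- fixed-point-free involutive automorphism.  This keeps every position
-- symmetric under σ with the two colours exchanged, and σ x is always free
-- because σ has no fixed points.  Hence any line Player II completes is the
-- σ-image of a line of Player I, already complete before II's move, so
-- Player I can never force Player II to lose.
module Submission where

open import Defs
open import Data.Nat using (ℕ)
open import Data.Fin using (Fin; _≟_)
open import Data.Fin.Subset renaming (_∈_ to _∈ₛ_) using ()
open import Data.Fin.Permutation using (Permutation′; _⟨$⟩ʳ_; _⟨$⟩ˡ_; inverseʳ)
open import Data.Vec.Properties using ([]=⇒lookup; lookup⇒[]=; lookup∘tabulate)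
open import Data.Product using (_,_; proj₁)
open import Data.Sum using (inj₁; inj₂)
open import Data.Empty using (⊥-elim)
open import Function using (_∘′_)
open import Relation.Nullary using (¬_; Dec; yes; no)
open import Relation.Binary.PropositionalEquality

opponent : Player → Player
opponent I  = II
opponent II = I

swapOwner : Cell → Cell
swapOwner free      = free
swapOwner (owned p) = owned (opponent p)

opponent-involutive : ∀ p → opponent (opponent p) ≡ p
opponent-involutive I  = refl
opponent-involutive II = refl

I≢II : I ≢ II
I≢II ()

owned-injective : ∀ {p q} → owned p ≡ owned q → p ≡ q
owned-injective refl = refl

claim-self : ∀ {n} (s : Position n) x p → claim s x p x ≡ owned p
claim-self s x p with x ≟ x
... | yes _  = refl
... | no x≢x = ⊥-elim (x≢x refl)

claim-other : ∀ {n} (s : Position n) x p {y} → y ≢ x → claim s x p y ≡ s y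
claim-other s x p {y} y≢x with y ≟ x
... | yes y≡x = ⊥-elim (y≢x y≡x)
... | no _    = refl

∈-image⁻ : ∀ {n} (π : Permutation′ n) {L y} → y ∈ₛ image π L → π ⟨$⟩ˡ y ∈ₛ L
∈-image⁻ π {L} {y} y∈πL =
  lookup⇒[]= _ L (trans (sym (lookup∘tabulate _ y)) ([]=⇒lookup y∈πL))

completedLine-unclaim : ∀ {n} (G : AvoidanceGame n) s x {p q} → q ≢ p →
  CompletedLine G (claim s x p) q → CompletedLine G s q
completedLine-unclaim G s x {p} {q} q≢p (L , L∈G , full) = L , L∈G , full′
  where
  full′ : ∀ y → y ∈ₛ L → s y ≡ owned q
  full′ y y∈L with y ≟ x
  ... | yes refl = ⊥-elim (q≢p (owned-injective (trans (sym (full x y∈L)) (claim-self s x p))))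
  ... | no y≢x   = trans (sym (claim-other s x p y≢x)) (full y y∈L)

module MirrorStrategy {n} (G : AvoidanceGame n) (π : Permutation′ n)
  (automorphism : IsAutomorphism G π)
  (involutive : ∀ x → π ⟨$⟩ʳ (π ⟨$⟩ʳ x) ≡ x) (fixedPointFree : ∀ x → π ⟨$⟩ʳ x ≢ x) where

  open ≡-Reasoning

  σ : Fin n → Fin n
  σ x = π ⟨$⟩ʳ x

  σ-injective : ∀ {x y} → σ x ≡ σ y → x ≡ y
  σ-injective {x} {y} σx≡σy = trans (sym (involutive x)) (trans (cong σ σx≡σy) (involutive y))

  σy≡x⇒y≡σx : ∀ {x y} → σ y ≡ x → y ≡ σ x
  σy≡x⇒y≡σx {x} {y} σy≡x = trans (sym (involutive y)) (cong σ σy≡x)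

  Mirrored : Position n → Set
  Mirrored s = ∀ y → s (σ y) ≡ swapOwner (s y)

  respondTo : Position n → Fin n → Player → Position n
  respondTo s x p = claim (claim s x p) (σ x) (opponent p)

  respondTo-self : ∀ s x p → respondTo s x p x ≡ owned p
  respondTo-self s x p = trans (claim-other _ (σ x) _ (fixedPointFree x ∘′ sym)) (claim-self s x p)

  respondTo-mirror : ∀ s x p → respondTo s x p (σ x) ≡ owned (opponent p)
  respondTo-mirror s x p = claim-self _ (σ x) (opponent p)

  respondTo-other : ∀ s x p {y} → y ≢ x → y ≢ σ x → respondTo s x p y ≡ s y
  respondTo-other s x p y≢x y≢σx = trans (claim-other _ (σ x) _ y≢σx) (claim-other s x p y≢x)

  mirrored-respondTo : ∀ {s} x p → Mirrored s → Mirrored (respondTo s x p)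
  mirrored-respondTo {s} x p mirrored y = mirrorAt y (y ≟ x) (y ≟ σ x)
    where
    mirrorAt : ∀ y → Dec (y ≡ x) → Dec (y ≡ σ x) →
      respondTo s x p (σ y) ≡ swapOwner (respondTo s x p y)
    mirrorAt .x (yes refl) _ = begin
      respondTo s x p (σ x)          ≡⟨ respondTo-mirror s x p ⟩
      owned (opponent p)             ≡⟨ cong swapOwner (respondTo-self s x p) ⟨
      swapOwner (respondTo s x p x)  ∎
    mirrorAt .(σ x) (no _) (yes refl) = begin
      respondTo s x p (σ (σ x))          ≡⟨ cong (respondTo s x p) (involutive x) ⟩
      respondTo s x p x                  ≡⟨ respondTo-self s x p ⟩
      owned p                            ≡⟨ cong owned (opponent-involutive p) ⟨
      swapOwner (owned (opponent p))     ≡⟨ cong swapOwner (respondTo-mirror s x p) ⟨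
      swapOwner (respondTo s x p (σ x))  ∎
    mirrorAt y (no y≢x) (no y≢σx) = begin
      respondTo s x p (σ y)          ≡⟨ respondTo-other s x p (y≢σx ∘′ σy≡x⇒y≡σx) (y≢x ∘′ σ-injective) ⟩
      s (σ y)                        ≡⟨ mirrored y ⟩
      swapOwner (s y)                ≡⟨ cong swapOwner (respondTo-other s x p y≢x y≢σx) ⟨
      swapOwner (respondTo s x p y)  ∎

  mirrored-start : Mirrored start
  mirrored-start _ = refl

  free-mirror-after-claim : ∀ {s} x p → Mirrored s → s x ≡ free → claim s x p (σ x) ≡ free
  free-mirror-after-claim {s} x p mirrored x-free = begin
    claim s x p (σ x)  ≡⟨ claim-other s x p (fixedPointFree x) ⟩
    s (σ x)            ≡⟨ mirrored x ⟩
    swapOwner (s x)    ≡⟨ cong swapOwner x-free ⟩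
    free               ∎

  completedLine-mirror : ∀ {s} p → Mirrored s → CompletedLine G s p → CompletedLine G s (opponent p)
  completedLine-mirror {s} p mirrored (L , L∈G , full) = image π L , proj₁ automorphism L L∈G , full′
    where
    full′ : ∀ y → y ∈ₛ image π L → s y ≡ owned (opponent p)
    full′ y y∈πL = begin
      s y                         ≡⟨ cong s (inverseʳ π) ⟨
      s (σ (π ⟨$⟩ˡ y))            ≡⟨ mirrored (π ⟨$⟩ˡ y) ⟩
      swapOwner (s (π ⟨$⟩ˡ y))    ≡⟨ cong swapOwner (full _ (∈-image⁻ π y∈πL)) ⟩
      owned (opponent p)          ∎

  ¬IWinI-mirrored : ∀ s → Mirrored s → ¬ IWinI G s
  ¬IWinI-mirrored s mirrored (move x x-free ¬I-completed (respond _ reply))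
    with reply (σ x) (free-mirror-after-claim x I mirrored x-free)
  ... | inj₁ II-completed = ¬I-completed
    (completedLine-unclaim G _ (σ x) I≢II (completedLine-mirror II (mirrored-respondTo x I mirrored) II-completed))
  ... | inj₂ I-wins = ¬IWinI-mirrored (respondTo s x I) (mirrored-respondTo x I mirrored) I-wins

lemma8 : ∀ (n : ℕ) (G : AvoidanceGame n) → Transitive G → HasFPFInvolution G →
    ¬ PlayerIWin G
lemma8 n G _ (π , automorphism , involutive , fixedPointFree) =
  ¬IWinI-mirrored start mirrored-start
  where open MirrorStrategy G π automorphism involutive fixedPointFree
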